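{- Let $G$ be a graph with $n$ vertices, $k\in\mathbb{N}_0$, and let $G'$ be the graph constructed from $G$ as described below, and $k'=3n+k$. Then $(G,k)$ is a yes-instance of \textsc{Feedback Vertex Set} if and only if $(G',k')$ is a yes-instance of \textsc{Feedback Vertex Set}.
   Context: \textsc{Feedback Vertex Set}: given an undirected graph $G=(V,E)$ and an integer $k\in\mathbb{N}_0$, decide whether there is $U\subseteq V$ with $|U|\le k$ such that $G-U$ is acyclic. Given a graph $G$ with $n$ vertices, $G'$ is obtained as follows: take a complete graph $H=K_{3n}$ disjoint from $G$; form the join of $G$ and $H$ (vertex set $V(G)\cup V(H)$, all edges of $G$ and $H$, plus every edge $\{v,w\}$ with $v\in V(G)$, $w\in V(H)$); then add two new vertices $x,y$, with $x$ adjacent to all vertices of $V(H)\cup\{y\}$ and $y$ adjacent to all vertices of $V(H)\cup\{x\}$. -}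

module Defs where

open import Data.Bool using (Bool; true; false; not)
open import Data.Nat using (ℕ; _+_; _*_; _≤_)
open import Data.Fin using (Fin; splitAt; _≟_)
open import Data.Fin.Subset using (Subset; _∉_; ∣_∣)
open import Data.Sum using (_⊎_; inj₁; inj₂)
open import Data.List using (List; []; _∷_; _++_; [_]; length)
open import Data.List.Relation.Unary.All using (All)
open import Data.List.Relation.Unary.Unique.Propositional using (Unique)
open import Data.Product using (Σ; _×_; _,_)
open import Relation.Nullary using (¬_; yes; no)
open import Relation.Nullary.Decidable using (⌊_⌋)
open import Relation.Binary.PropositionalEquality using (_≡_; refl; sym)

record Graph (n : ℕ) : Set where
  field
    adj    : Fin n → Fin n → Bool
    symm   : ∀ u v → adj u v ≡ adj v u
    noLoop : ∀ v → adj v v ≡ false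
open Graph public

data Walk {n : ℕ} (G : Graph n) : List (Fin n) → Set where
  nil  : Walk G []
  one  : ∀ v → Walk G [ v ]
  cons : ∀ u v vs → adj G u v ≡ true → Walk G (v ∷ vs) → Walk G (u ∷ v ∷ vs)

record CycleAvoiding {n : ℕ} (G : Graph n) (U : Subset n) : Set where
  field
    v₀       : Fin n
    rest     : List (Fin n)
    long     : 2 ≤ length rest
    distinct : Unique (v₀ ∷ rest)
    avoids   : All (λ v → v ∉ U) (v₀ ∷ rest)
    closed   : Walk G (v₀ ∷ rest ++ [ v₀ ])

AcyclicWithout : {n : ℕ} → Graph n → Subset n → Set
AcyclicWithout G U = ¬ CycleAvoiding G U

FVS : {n : ℕ} → Graph n → ℕ → Set
FVS {n} G k = Σ (Subset n) λ U → (∣ U ∣ ≤ k) × AcyclicWithout G U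

-- The construction G'.  Vertex set Fin (n + (3n + 2)):
-- first n vertices = V(G), next 3n = V(H) (H = K_{3n}), last two = x , y.

data Kind (n : ℕ) : Set where
  gv : Fin n → Kind n
  hv : Fin (3 * n) → Kind n
  xv : Kind n
  yv : Kind n

kind : ∀ {n} → Fin (n + (3 * n + 2)) → Kind n
kind {n} v with splitAt n v
... | inj₁ a = gv a
... | inj₂ b with splitAt (3 * n) b
...   | inj₁ h = hv h
...   | inj₂ Fin.zero = xv
...   | inj₂ (Fin.suc _) = yv

kadj : ∀ {n} → Graph n → Kind n → Kind n → Bool
kadj G (gv a) (gv b) = adj G a b
kadj G (gv _) (hv _) = true
kadj G (hv _) (gv _) = true
kadj G (hv i) (hv j) = not ⌊ i ≟ j ⌋
kadj G (hv _) xv = true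
kadj G (hv _) yv = true
kadj G xv (hv _) = true
kadj G yv (hv _) = true
kadj G xv yv = true
kadj G yv xv = true
kadj G _ _ = false

private
  ≟-sym : ∀ {m} (i j : Fin m) → not ⌊ i ≟ j ⌋ ≡ not ⌊ j ≟ i ⌋
  ≟-sym i j with i ≟ j | j ≟ i
  ... | yes _ | yes _ = refl
  ... | no _  | no _  = refl
  ... | yes p | no q  with q (sym p)
  ... | ()
  ≟-sym i j | no p | yes q with p (sym q)
  ... | ()

  ≟-refl : ∀ {m} (i : Fin m) → not ⌊ i ≟ i ⌋ ≡ false
  ≟-refl i with i ≟ i
  ... | yes _ = refl
  ... | no p with p refl
  ... | ()

  kadj-sym : ∀ {n} (G : Graph n) a b → kadj G a b ≡ kadj G b a
  kadj-sym G (gv a) (gv b) = symm G a b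
  kadj-sym G (gv _) (hv _) = refl
  kadj-sym G (gv _) xv = refl
  kadj-sym G (gv _) yv = refl
  kadj-sym G (hv _) (gv _) = refl
  kadj-sym G (hv i) (hv j) = ≟-sym i j
  kadj-sym G (hv _) xv = refl
  kadj-sym G (hv _) yv = refl
  kadj-sym G xv (gv _) = refl
  kadj-sym G xv (hv _) = refl
  kadj-sym G xv xv = refl
  kadj-sym G xv yv = refl
  kadj-sym G yv (gv _) = refl
  kadj-sym G yv (hv _) = refl
  kadj-sym G yv xv = refl
  kadj-sym G yv yv = refl

  kadj-loop : ∀ {n} (G : Graph n) a → kadj G a a ≡ false
  kadj-loop G (gv a) = noLoop G a
  kadj-loop G (hv i) = ≟-refl i
  kadj-loop G xv = refl
  kadj-loop G yv = refl

-- G' : join of G with K_{3n}, plus x , y adjacent to each other and to all of H.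
G′ : ∀ {n} → Graph n → Graph (n + (3 * n + 2))
G′ G = record
  { adj    = λ u v → kadj G (kind u) (kind v)
  ; symm   = λ u v → kadj-sym G (kind u) (kind v)
  ; noLoop = λ v → kadj-loop G (kind v)
  }

module Submission where

-- If G − U is a forest then so is G′ − (U ∪ V(H)): what remains is G − U together with
-- the single edge xy, and no edge joins the two parts. Conversely V(H) ∪ {x, y} is a
-- clique of size 3n + 2 in G′, so three of its vertices outside a feedback vertex set
-- would span a triangle; hence such a set contains at least 3n of them, and its at
-- most k remaining vertices lie in V(G) and meet every cycle of the induced subgraph G.

open import Defs
open import Data.Bool using (true; false)
open import Data.Empty using (⊥; ⊥-elim)
open import Data.Fin as Fin using (Fin; zero; suc; _↑ˡ_; _↑ʳ_; splitAt)
open import Data.Fin.Properties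
  using (splitAt-↑ˡ; splitAt⁻¹-↑ˡ; splitAt⁻¹-↑ʳ; ↑ˡ-injective; ↑ʳ-injective; suc-injective)
open import Data.Fin.Subset using (Subset; _∈_; _∉_; ∣_∣; ⊤) renaming (⊥ to ∅)
open import Data.Fin.Subset.Properties using (∈⊤; ∣⊤∣≡n; ∣⊥∣≡0; drop-there)
open import Data.List using (List; []; _∷_; [_]; length; map)
open import Data.List.Properties using (map-++; length-map)
open import Data.List.Relation.Unary.All as All using (All; []; _∷_)
import Data.List.Relation.Unary.All.Properties as All
open import Data.List.Relation.Unary.Unique.Propositional using (Unique; []; _∷_)
import Data.List.Relation.Unary.Unique.Propositional.Properties as Unique
open import Data.Nat using (ℕ; _+_; _*_; _≤_; s≤s; z≤n)
open import Data.Nat.Properties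
  using (+-comm; +-suc; +-identityʳ; +-cancelˡ-≤; +-monoˡ-≤; +-monoʳ-≤; module ≤-Reasoning)
open import Data.Product using (_,_)
open import Data.Sum using (inj₁; inj₂)
open import Data.Unit using (tt) renaming (⊤ to Unit)
open import Data.Vec as Vec using (here; there)
open import Function using (_∘_)
open import Function.Bundles using (_⇔_; mk⇔)
open import Relation.Binary.PropositionalEquality hiding ([_])
open import Relation.Nullary using (yes; no)

private
  variable
    m c : ℕ

∣p++q∣≡∣p∣+∣q∣ : (p : Subset m) (q : Subset c) → ∣ p Vec.++ q ∣ ≡ ∣ p ∣ + ∣ q ∣
∣p++q∣≡∣p∣+∣q∣ Vec.[]          q = refl
∣p++q∣≡∣p∣+∣q∣ (true  Vec.∷ p) q = cong ℕ.suc (∣p++q∣≡∣p∣+∣q∣ p q)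
∣p++q∣≡∣p∣+∣q∣ (false Vec.∷ p) q = ∣p++q∣≡∣p∣+∣q∣ p q

∈-++⁺ˡ : {p : Subset m} {q : Subset c} {i : Fin m} → i ∈ p → i ↑ˡ c ∈ p Vec.++ q
∈-++⁺ˡ here        = here
∈-++⁺ˡ (there i∈p) = there (∈-++⁺ˡ i∈p)

∈-++⁺ʳ : (p : Subset m) {q : Subset c} {i : Fin c} → i ∈ q → m ↑ʳ i ∈ p Vec.++ q
∈-++⁺ʳ Vec.[]      i∈q = i∈q
∈-++⁺ʳ (_ Vec.∷ p) i∈q = there (∈-++⁺ʳ p i∈q)

∈-++⁻ˡ : (p : Subset m) {q : Subset c} {i : Fin m} → i ↑ˡ c ∈ p Vec.++ q → i ∈ p
∈-++⁻ˡ (_ Vec.∷ p) {i = zero}  here      = here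
∈-++⁻ˡ (_ Vec.∷ p) {i = suc i} (there x) = there (∈-++⁻ˡ p x)

∈-++⁻ʳ : (p : Subset m) {q : Subset c} {i : Fin c} → m ↑ʳ i ∈ p Vec.++ q → i ∈ q
∈-++⁻ʳ Vec.[]      x         = x
∈-++⁻ʳ (_ Vec.∷ p) (there x) = ∈-++⁻ʳ p x

↑ˡ≢↑ʳ : (a : Fin m) (i : Fin c) → a ↑ˡ c ≢ m ↑ʳ i
↑ˡ≢↑ʳ zero    i ()
↑ˡ≢↑ʳ (suc a) i e = ↑ˡ≢↑ʳ a i (suc-injective e)

outside : Subset m → List (Fin m)
outside Vec.[]          = []
outside (true  Vec.∷ p) = map suc (outside p)
outside (false Vec.∷ p) = zero ∷ map suc (outside p)

outside-unique : (p : Subset m) → Unique (outside p)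
outside-unique Vec.[]          = []
outside-unique (true  Vec.∷ p) = Unique.map⁺ suc-injective (outside-unique p)
outside-unique (false Vec.∷ p) =
  All.map⁺ (All.universal (λ _ ()) (outside p)) ∷ Unique.map⁺ suc-injective (outside-unique p)

outside-∉ : (p : Subset m) → All (_∉ p) (outside p)
outside-∉ Vec.[]          = []
outside-∉ (true  Vec.∷ p) = All.map⁺ (All.map (λ i∉p → i∉p ∘ drop-there) (outside-∉ p))
outside-∉ (false Vec.∷ p) = (λ ()) ∷ All.map⁺ (All.map (λ i∉p → i∉p ∘ drop-there) (outside-∉ p))

length-outside : (p : Subset m) → length (outside p) + ∣ p ∣ ≡ m
length-outside Vec.[]          = refl
length-outside (true  Vec.∷ p) = begin
  length (map suc (outside p)) + ℕ.suc ∣ p ∣ ≡⟨ cong (_+ ℕ.suc ∣ p ∣) (length-map suc (outside p)) ⟩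
  length (outside p) + ℕ.suc ∣ p ∣           ≡⟨ +-suc (length (outside p)) ∣ p ∣ ⟩
  ℕ.suc (length (outside p) + ∣ p ∣)         ≡⟨ cong ℕ.suc (length-outside p) ⟩
  _                                          ∎
  where open ≡-Reasoning
length-outside (false Vec.∷ p) =
  cong ℕ.suc (trans (cong (_+ ∣ p ∣) (length-map suc (outside p))) (length-outside p))

module _ {m m′} {G : Graph m} {G′ : Graph m′} {U : Subset m} {U′ : Subset m′}
         (P : Fin m → Set) (f : Fin m → Fin m′)
         (f-injective : ∀ {u v} → P u → P v → f u ≡ f v → u ≡ v)
         (f-adj : ∀ {u v} → P u → P v → adj G u v ≡ true → adj G′ (f u) (f v) ≡ true)
         (f-∉ : ∀ {v} → P v → v ∉ U → f v ∉ U′)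
         where

  walk-map : ∀ {xs} → All P xs → Walk G xs → Walk G′ (map f xs)
  walk-map _                  nil                = nil
  walk-map _                  (one v)            = one (f v)
  walk-map (pu ∷ ps@(pv ∷ _)) (cons u v vs e w) = cons (f u) (f v) (map f vs) (f-adj pu pv e) (walk-map ps w)

  unique-map : ∀ {xs} → All P xs → Unique xs → Unique (map f xs)
  unique-map []       []           = []
  unique-map (p ∷ ps) (x≢xs ∷ xs!) =
    All.map⁺ (All.zipWith (λ (q , x≢y) → x≢y ∘ f-injective p q) (ps , x≢xs)) ∷ unique-map ps xs!

  cycle-map : (C : CycleAvoiding G U) → All P (CycleAvoiding.v₀ C ∷ CycleAvoiding.rest C) → CycleAvoiding G′ U′
  cycle-map C ps = record
    { v₀       = f v₀
    ; rest     = map f rest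
    ; long     = subst (2 ≤_) (sym (length-map f rest)) long
    ; distinct = unique-map ps distinct
    ; avoids   = All.map⁺ (All.zipWith (λ (p , v∉U) → f-∉ p v∉U) (ps , avoids))
    ; closed   = subst (Walk G′) (cong (f v₀ ∷_) (map-++ f rest [ v₀ ]))
                   (walk-map (All.++⁺ ps (All.head ps ∷ [])) closed)
    }
    where open CycleAvoiding C

adj⇒≢ : (G : Graph m) {u v : Fin m} → adj G u v ≡ true → u ≢ v
adj⇒≢ G {u} e refl with trans (sym e) (noLoop G u)
... | ()

triangle : (G : Graph m) {U : Subset m} {u v w : Fin m} →
           adj G u v ≡ true → adj G v w ≡ true → adj G w u ≡ true →
           u ∉ U → v ∉ U → w ∉ U → CycleAvoiding G U
triangle G {u = u} {v} {w} uv vw wu u∉ v∉ w∉ = record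
  { v₀       = u
  ; rest     = v ∷ w ∷ []
  ; long     = s≤s (s≤s z≤n)
  ; distinct = (adj⇒≢ G uv ∷ (adj⇒≢ G wu ∘ sym) ∷ []) ∷ (adj⇒≢ G vw ∷ []) ∷ [] ∷ []
  ; avoids   = u∉ ∷ v∉ ∷ w∉ ∷ []
  ; closed   = cons u v _ uv (cons v w _ vw (cons w u _ wu (one u)))
  }

clique-cover : (G : Graph m) {U : Subset m} → AcyclicWithout G U →
               (f : Fin c → Fin m) → (∀ {i j} → i ≢ j → adj G (f i) (f j) ≡ true) →
               (W : Subset c) → (∀ {i} → i ∉ W → f i ∉ U) → c ≤ 2 + ∣ W ∣
clique-cover {c = c} G acyclic f clique W cover = begin
  c                              ≡⟨ sym (length-outside W) ⟩
  length (outside W) + ∣ W ∣     ≤⟨ +-monoˡ-≤ ∣ W ∣ (at-most-two (outside-unique W) (outside-∉ W)) ⟩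
  2 + ∣ W ∣                      ∎
  where
  open ≤-Reasoning
  at-most-two : ∀ {is} → Unique is → All (_∉ W) is → length is ≤ 2
  at-most-two {[]}          _ _ = z≤n
  at-most-two {_ ∷ []}      _ _ = s≤s z≤n
  at-most-two {_ ∷ _ ∷ []}  _ _ = s≤s (s≤s z≤n)
  at-most-two {_ ∷ _ ∷ _ ∷ _} ((i≢j ∷ i≢l ∷ _) ∷ (j≢l ∷ _) ∷ _) (i∉ ∷ j∉ ∷ l∉ ∷ _) =
    ⊥-elim (acyclic (triangle G (clique i≢j) (clique j≢l) (clique (i≢l ∘ sym)) (cover i∉) (cover j∉) (cover l∉)))

module _ {n : ℕ} where

  vertex : Kind n → Fin (n + (3 * n + 2))
  vertex (gv a) = a ↑ˡ (3 * n + 2)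
  vertex (hv h) = n ↑ʳ (h ↑ˡ 2)
  vertex xv     = n ↑ʳ (3 * n ↑ʳ zero)
  vertex yv     = n ↑ʳ (3 * n ↑ʳ suc zero)

  vertex-kind : ∀ v → vertex (kind v) ≡ v
  vertex-kind v with splitAt n v in eq
  ... | inj₁ a = splitAt⁻¹-↑ˡ eq
  ... | inj₂ b with splitAt (3 * n) b in eq′
  ...   | inj₁ h          = trans (cong (n ↑ʳ_) (splitAt⁻¹-↑ˡ eq′)) (splitAt⁻¹-↑ʳ eq)
  ...   | inj₂ zero       = trans (cong (n ↑ʳ_) (splitAt⁻¹-↑ʳ eq′)) (splitAt⁻¹-↑ʳ eq)
  ...   | inj₂ (suc zero) = trans (cong (n ↑ʳ_) (splitAt⁻¹-↑ʳ eq′)) (splitAt⁻¹-↑ʳ eq)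

  kind-injective : ∀ {u v} → kind {n} u ≡ kind v → u ≡ v
  kind-injective {u} {v} e = trans (sym (vertex-kind u)) (trans (cong vertex e) (vertex-kind v))

  kind-↑ˡ : ∀ a → kind (a ↑ˡ (3 * n + 2)) ≡ gv a
  kind-↑ˡ a rewrite splitAt-↑ˡ n a (3 * n + 2) = refl

  kind-↑ʳ≢gv : ∀ i a → kind (n ↑ʳ i) ≢ gv a
  kind-↑ʳ≢gv i a e = ↑ˡ≢↑ʳ a i (trans (sym (cong vertex e)) (vertex-kind (n ↑ʳ i)))

  data XY : Kind n → Set where
    isx : XY xv
    isy : XY yv

  data OutsideH : Kind n → Set where
    inG  : ∀ a → OutsideH (gv a)
    inXY : ∀ {k} → XY k → OutsideH k

  -- a₀ is a junk value for the kinds that are not G-vertices.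
  base : Fin n → Kind n → Fin n
  base _  (gv a) = a
  base a₀ _      = a₀

  H : Subset (3 * n + 2)
  H = ⊤ {3 * n} Vec.++ ∅ {2}

  ∣H∣ : ∣ H ∣ ≡ 3 * n
  ∣H∣ = trans (∣p++q∣≡∣p∣+∣q∣ (⊤ {3 * n}) (∅ {2})) (trans (cong₂ _+_ (∣⊤∣≡n (3 * n)) (∣⊥∣≡0 2)) (+-identityʳ (3 * n)))

  U+H : Subset n → Subset (n + (3 * n + 2))
  U+H U = U Vec.++ H

  ∣U+H∣ : ∀ U → ∣ U+H U ∣ ≡ ∣ U ∣ + 3 * n
  ∣U+H∣ U = trans (∣p++q∣≡∣p∣+∣q∣ U H) (cong (∣ U ∣ +_) ∣H∣)

  outsideH : ∀ U {v} → v ∉ U+H U → OutsideH (kind v)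
  outsideH U {v} v∉ = classify (kind v) refl
    where
    classify : ∀ k → kind v ≡ k → OutsideH k
    classify (gv a) _ = inG a
    classify (hv h) e = ⊥-elim (v∉ (subst (_∈ U+H U) (trans (cong vertex (sym e)) (vertex-kind v))
                                      (∈-++⁺ʳ U (∈-++⁺ˡ ∈⊤))))
    classify xv     _ = inXY isx
    classify yv     _ = inXY isy

  module _ (G : Graph n) where

    kadj-clique : ∀ {k l} → (∀ a → k ≢ gv a) → (∀ a → l ≢ gv a) → k ≢ l → kadj G k l ≡ true
    kadj-clique {gv a}          k∉G _   _   = ⊥-elim (k∉G a refl)
    kadj-clique {l = gv a}      _   l∉G _   = ⊥-elim (l∉G a refl)
    kadj-clique {hv i} {hv j}   _   _   k≢l with i Fin.≟ j
    ... | yes i≡j = ⊥-elim (k≢l (cong hv i≡j))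
    ... | no  _   = refl
    kadj-clique {hv _} {xv}     _   _   _   = refl
    kadj-clique {hv _} {yv}     _   _   _   = refl
    kadj-clique {xv}   {hv _}   _   _   _   = refl
    kadj-clique {xv}   {xv}     _   _   k≢l = ⊥-elim (k≢l refl)
    kadj-clique {xv}   {yv}     _   _   _   = refl
    kadj-clique {yv}   {hv _}   _   _   _   = refl
    kadj-clique {yv}   {xv}     _   _   _   = refl
    kadj-clique {yv}   {yv}     _   _   k≢l = ⊥-elim (k≢l refl)

    gv-neighbour : ∀ a₀ {a l} → kadj G (gv a) l ≡ true → OutsideH l → l ≡ gv (base a₀ l)
    gv-neighbour _ _  (inG _)     = refl
    gv-neighbour _ () (inXY isx)
    gv-neighbour _ () (inXY isy)

    -- Outside H, the only neighbour of x is y and vice versa.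
    xy-return : ∀ {k l k′} → XY k → kadj G k l ≡ true → kadj G l k′ ≡ true → OutsideH l → OutsideH k′ → k′ ≡ k
    xy-return isx () _  (inG _)    _
    xy-return isx () _  (inXY isx) _
    xy-return isx _  () (inXY isy) (inG _)
    xy-return isx _  _  (inXY isy) (inXY isx) = refl
    xy-return isx _  () (inXY isy) (inXY isy)
    xy-return isy () _  (inG _)    _
    xy-return isy () _  (inXY isy) _
    xy-return isy _  () (inXY isx) (inG _)
    xy-return isy _  _  (inXY isx) (inXY isy) = refl
    xy-return isy _  () (inXY isx) (inXY isx)

    ↑ʳ-clique : ∀ {i j} → i ≢ j → adj (G′ G) (n ↑ʳ i) (n ↑ʳ j) ≡ true
    ↑ʳ-clique i≢j = kadj-clique (kind-↑ʳ≢gv _) (kind-↑ʳ≢gv _) (i≢j ∘ ↑ʳ-injective n _ _ ∘ kind-injective)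

    module _ (U : Subset n) where

      module _ (a₀ : Fin n) where

        InG : Fin (n + (3 * n + 2)) → Set
        InG v = kind v ≡ gv (base a₀ (kind v))

        walk-stays-in-G : ∀ {u vs} → Walk (G′ G) (u ∷ vs) → InG u → All (_∉ U+H U) vs → All InG vs
        walk-stays-in-G (one _)              _  []          = []
        walk-stays-in-G (cons u v _ uv walk) Gu (v∉ ∷ vs∉) = Gv ∷ walk-stays-in-G walk Gv vs∉
          where
          Gv : InG v
          Gv = gv-neighbour a₀ (subst (λ k → kadj G k (kind v) ≡ true) Gu uv) (outsideH U v∉)

        cycle-to-G : (C : CycleAvoiding (G′ G) (U+H U)) → InG (CycleAvoiding.v₀ C) → CycleAvoiding G U
        cycle-to-G C G₀ = cycle-map InG (base a₀ ∘ kind)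
          (λ Gu Gv e → kind-injective (trans Gu (trans (cong gv e) (sym Gv))))
          (λ Gu Gv → subst (_≡ true) (cong₂ (kadj G) Gu Gv))
          (λ {v} Gv v∉ a∈U → v∉ (subst (_∈ U+H U) (trans (cong vertex (sym Gv)) (vertex-kind v)) (∈-++⁺ˡ a∈U)))
          C (G₀ ∷ All.++⁻ˡ rest (walk-stays-in-G closed G₀ (All.++⁺ (All.tail avoids) (All.head avoids ∷ []))))
          where open CycleAvoiding C

      no-xy-cycle : (C : CycleAvoiding (G′ G) (U+H U)) → XY (kind (CycleAvoiding.v₀ C)) → ⊥
      no-xy-cycle record { rest = [] ; long = () }
      no-xy-cycle record { rest = _ ∷ [] ; long = s≤s () }
      no-xy-cycle record { rest = _ ∷ _ ∷ _ ; distinct = (_ ∷ v₀≢r₂ ∷ _) ∷ _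
                         ; avoids = _ ∷ r₁∉ ∷ r₂∉ ∷ _ ; closed = cons _ _ _ e₁ (cons _ _ _ e₂ _) } xy =
        v₀≢r₂ (sym (kind-injective (xy-return xy e₁ e₂ (outsideH U r₁∉) (outsideH U r₂∉))))

      acyclic-U+H : AcyclicWithout G U → AcyclicWithout (G′ G) (U+H U)
      acyclic-U+H acyclic C = from-start (outsideH U (All.head avoids)) refl
        where
        open CycleAvoiding C
        from-start : ∀ {k} → OutsideH k → kind v₀ ≡ k → ⊥
        from-start (inG a₀)  e = acyclic (cycle-to-G a₀ C (trans e (cong (gv ∘ base a₀) (sym e))))
        from-start (inXY xy) e = no-xy-cycle C (subst XY (sym e) xy)

    module _ (A : Subset n) (W : Subset (3 * n + 2)) (acyclic : AcyclicWithout (G′ G) (A Vec.++ W)) where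

      acyclic-restrict : AcyclicWithout G A
      acyclic-restrict C = acyclic (cycle-map (λ _ → Unit) (_↑ˡ (3 * n + 2))
        (λ _ _ → ↑ˡ-injective _ _ _)
        (λ {u} {v} _ _ → subst (_≡ true) (sym (cong₂ (kadj G) (kind-↑ˡ u) (kind-↑ˡ v))))
        (λ _ a∉A → a∉A ∘ ∈-++⁻ˡ A)
        C (All.universal (λ _ → tt) _))

      3n≤∣W∣ : 3 * n ≤ ∣ W ∣
      3n≤∣W∣ = +-cancelˡ-≤ 2 _ _ (begin
        2 + 3 * n   ≡⟨ +-comm 2 (3 * n) ⟩
        3 * n + 2   ≤⟨ clique-cover (G′ G) acyclic (n ↑ʳ_) ↑ʳ-clique W (λ i∉W → i∉W ∘ ∈-++⁻ʳ A) ⟩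
        2 + ∣ W ∣   ∎)
        where open ≤-Reasoning

      ∣restrict∣≤ : ∀ k → ∣ A Vec.++ W ∣ ≤ 3 * n + k → ∣ A ∣ ≤ k
      ∣restrict∣≤ k size = +-cancelˡ-≤ (3 * n) _ _ (begin
        3 * n + ∣ A ∣   ≤⟨ +-monoˡ-≤ ∣ A ∣ 3n≤∣W∣ ⟩
        ∣ W ∣ + ∣ A ∣   ≡⟨ +-comm ∣ W ∣ ∣ A ∣ ⟩
        ∣ A ∣ + ∣ W ∣   ≡⟨ sym (∣p++q∣≡∣p∣+∣q∣ A W) ⟩
        ∣ A Vec.++ W ∣  ≤⟨ size ⟩
        3 * n + k       ∎)
        where open ≤-Reasoning

lemma30 : (n : ℕ) (G : Graph n) (k : ℕ) → FVS G k ⇔ FVS (G′ G) (3 * n + k)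
lemma30 n G k = mk⇔ forward backward
  where
  open ≤-Reasoning

  forward : FVS G k → FVS (G′ G) (3 * n + k)
  forward (U , ∣U∣≤k , acyclic) = U+H U , size , acyclic-U+H G U acyclic
    where
    size : ∣ U+H U ∣ ≤ 3 * n + k
    size = begin
      ∣ U+H U ∣     ≡⟨ ∣U+H∣ U ⟩
      ∣ U ∣ + 3 * n ≡⟨ +-comm ∣ U ∣ (3 * n) ⟩
      3 * n + ∣ U ∣ ≤⟨ +-monoʳ-≤ (3 * n) ∣U∣≤k ⟩
      3 * n + k     ∎

  backward : FVS (G′ G) (3 * n + k) → FVS G k
  backward (U′ , size , acyclic) with Vec.splitAt n U′
  ... | A , W , refl = A , ∣restrict∣≤ G A W acyclic k size , acyclic-restrict G A W acyclic
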